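{- Let $C\subset V(\frac12 Q_{24})$ be a union of spheres such that the characteristic function $\chi_C$ is a perfect coloring of $\frac12 Q_{24}$ with parameters $((20+c,256-c)(c,276-c))$. Then either $c$ is divisible by $3$, or $c\ge 25$.
   Context: $\frac12 Q_{24}$ is the graph on binary words of length $24$ with an even number of ones, adjacent iff they differ in exactly two positions; $\frac12 Q_{24}'$ is the analogous graph on odd-weight words. A sphere is a set $S\subset V(\frac12 Q_{24})$ consisting of all $24$ words at Hamming distance $1$ from some word (the centre) of $V(\frac12 Q_{24}')$. $\chi_C$ is a perfect coloring with parameters $((a,b)(c,d))$ means $\emptyset\ne C\ne V$, every vertex of $C$ has exactly $a$ neighbours in $C$ and $b$ outside, and every vertex outside $C$ has exactly $c$ neighbours in $C$ and $d$ outside. -}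

module Defs where

open import Data.Bool using (Bool; true; false; not; _∧_; if_then_else_)
open import Data.Nat using (ℕ; zero; suc; _+_; _<ᵇ_)
open import Data.Nat.Divisibility using (_∣_)
open import Relation.Nullary using (¬_)
open import Data.Fin using (Fin; toℕ; _≟_)
open import Data.Vec using (Vec; lookup; updateAt; count)
open import Data.List using (List; []; _∷_; concatMap; filter; length; allFin)
open import Data.Product using (Σ; _×_; _,_; ∃)
open import Relation.Binary.PropositionalEquality using (_≡_)
open import Relation.Nullary.Decidable using (Dec; yes; no)
open import Data.Bool.Properties using () renaming (_≟_ to _≟B_)

Word : Set
Word = Vec Bool 24

weight : Word → ℕ
weight w = count (λ b → b ≟B true) w

flip : Word → Fin 24 → Word
flip w i = updateAt w i not

-- vertices of ½Q₂₄ : even weight words; of ½Q₂₄' : odd weight words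
IsVertex : Word → Set
IsVertex w = 2 ∣ weight w

IsCentre : Word → Set
IsCentre w = ¬ (2 ∣ weight w)

pairs : List (Fin 24 × Fin 24)
pairs = concatMap (λ i → concatMap (λ j → if toℕ i <ᵇ toℕ j then (i , j) ∷ [] else []) (allFin 24)) (allFin 24)

neighbours : Word → List Word
neighbours x = Data.List.map (λ p → flip (flip x (Data.Product.proj₁ p)) (Data.Product.proj₂ p)) pairs

nIn : (Word → Bool) → Word → ℕ
nIn C x = length (filter (λ y → C y ≟B true) (neighbours x))

nOut : (Word → Bool) → Word → ℕ
nOut C x = length (filter (λ y → C y ≟B false) (neighbours x))

OnSphere : Word → Word → Set
OnSphere t y = ∃ λ (i : Fin 24) → y ≡ flip t i

-- C (a subset of V(½Q₂₄)) is a union of spheres: every element of C lies on some sphere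
-- (centre an odd-weight word) entirely contained in C
IsUnionOfSpheres : (Word → Bool) → Set
IsUnionOfSpheres C =
  ∀ x → IsVertex x → C x ≡ true →
    Σ Word λ t → IsCentre t × OnSphere t x × (∀ y → OnSphere t y → C y ≡ true)

PerfectColoring : (Word → Bool) → ℕ → ℕ → ℕ → ℕ → Set
PerfectColoring C a b c d =
  (Σ Word λ x → IsVertex x × C x ≡ true) ×
  (Σ Word λ x → IsVertex x × C x ≡ false) ×
  (∀ x → IsVertex x → C x ≡ true → nIn C x ≡ a × nOut C x ≡ b) ×
  (∀ x → IsVertex x → C x ≡ false → nIn C x ≡ c × nOut C x ≡ d)

-- Fix a vertex y outside C and write c for its number of neighbours in C.  Every neighbour
-- y + eᵢ + eⱼ in C lies on a sphere inside C; its centre is y + eᵢ + eⱼ + eₖ with k ∉ {i, j},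
-- since a sphere through y would put y in C.  If no neighbour of y lies on two such spheres,
-- the neighbours of y in C are partitioned into triples, one per full sphere centred at
-- distance 3 from y, and 3 ∣ c.  Otherwise a neighbour x ∈ C lies on two full spheres with
-- centres x + eₖ, x + eₖ' (k ≠ k'), and then every x + eₚ + e_q with {p, q} ∩ {k, k'} ≠ ∅ is
-- in C; these are 276 − 231 = 45 neighbours of x, so 20 + c ≥ 45.
module Submission where

open import Defs
open import Data.Bool using (Bool; true; false; not; if_then_else_; T)
open import Data.Bool.Properties using (not-involutive) renaming (_≟_ to _≟B_)
open import Data.Empty using (⊥-elim)
open import Data.Fin using (Fin; zero; suc; toℕ; _≟_)
open import Data.Fin.Properties using (toℕ-injective; all?; any?)
open import Data.List using (List; []; _∷_; map; filter; length; concatMap; tabulate)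
open import Data.List.Properties using (map-++; filter-++; length-++)
open import Data.Nat using (ℕ; zero; suc; _+_; _*_; _∸_; _≤_; _<_; _<ᵇ_; z≤n)
open import Data.Nat.Divisibility using (_∣_; divides; ∣-refl; ∣m∣n⇒∣m+n; ∣m+n∣m⇒∣n)
open import Data.Nat.Properties
  using (<⇒<ᵇ; <ᵇ⇒<; <-cmp; <-asym; <-trans; ≤-trans; ≤-refl; +-mono-≤; *-monoʳ-≤; +-cancelˡ-≤; _≤?_;
         +-*-semiring)
open import Algebra.Properties.Semiring.Sum +-*-semiring
  using (sum-syntax; sum-cong-≗; sum-replicate-zero; ∑-distrib-+; ∑-comm; *-distribˡ-sum)
open import Data.Nat.Tactic.RingSolver using (solve-∀)
open import Data.Product using (_×_; _,_; ∃; proj₁)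
open import Data.Sum using (_⊎_; inj₁; inj₂; [_,_]′)
open import Data.Unit using (tt)
open import Data.Vec using (Vec; _∷_; updateAt; count; lookup)
open import Data.Vec.Properties using (updateAt-updateAt-local; updateAt-id; updateAt-commutes)
open import Function using (id; _∘_)
open import Relation.Binary using (tri<; tri≈; tri>)
open import Relation.Binary.PropositionalEquality
open import Relation.Nullary using (¬_; Dec; yes; no; does; contradiction)
open import Relation.Nullary.Decidable using (_×-dec_; _⊎-dec_; ¬?; toWitness; toSum; dec-true; dec-false)
open import Relation.Unary using (Decidable)

χ : Bool → ℕ
χ true  = 1
χ false = 0

does-≟-true : ∀ b → does (b ≟B true) ≡ b
does-≟-true true  = refl
does-≟-true false = refl

χ-does-≤ : ∀ {P : Set} (P? : Dec P) {b} → (P → b ≡ true) → χ (does P?) ≤ χ b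
χ-does-≤ (yes p) P⇒b rewrite P⇒b p = ≤-refl
χ-does-≤ (no _)  _   = z≤n

flip-involutive : ∀ (w : Word) i → flip (flip w i) i ≡ w
flip-involutive w i =
  trans (updateAt-updateAt-local i w (not-involutive (lookup w i))) (updateAt-id i w)

flip-comm : ∀ (w : Word) i j → flip (flip w i) j ≡ flip (flip w j) i
flip-comm w i j with i ≟ j
... | yes refl = refl
... | no  i≢j  = updateAt-commutes j i (λ j≡i → i≢j (sym j≡i)) w

OneApart : ℕ → ℕ → Set
OneApart m n = suc m ≡ n ⊎ suc n ≡ m

count-true-updateAt-not : ∀ {n} (w : Vec Bool n) i →
  OneApart (count (_≟B true) w) (count (_≟B true) (updateAt w i not))
count-true-updateAt-not (true  ∷ w) zero    = inj₂ refl
count-true-updateAt-not (false ∷ w) zero    = inj₁ refl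
count-true-updateAt-not (false ∷ w) (suc i) = count-true-updateAt-not w i
count-true-updateAt-not (true  ∷ w) (suc i) with count-true-updateAt-not w i
... | inj₁ e = inj₁ (cong suc e)
... | inj₂ e = inj₂ (cong suc e)

even-after-two-steps : ∀ {l m n} → 2 ∣ l → OneApart l m → OneApart m n → 2 ∣ n
even-after-two-steps 2∣l (inj₁ refl) (inj₁ refl) = ∣m∣n⇒∣m+n (∣-refl {2}) 2∣l
even-after-two-steps 2∣l (inj₁ refl) (inj₂ refl) = 2∣l
even-after-two-steps 2∣l (inj₂ refl) (inj₁ refl) = 2∣l
even-after-two-steps 2∣l (inj₂ refl) (inj₂ refl) = ∣m+n∣m⇒∣n {m = 2} 2∣l (∣-refl {2})

IsVertex-flip-flip : ∀ y i j → IsVertex y → IsVertex (flip (flip y i) j)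
IsVertex-flip-flip y i j y-even =
  even-after-two-steps y-even (count-true-updateAt-not y i) (count-true-updateAt-not (flip y i) j)

∑-zero : ∀ {n} (f : Fin n → ℕ) → (∀ i → f i ≡ 0) → ∑[ i < n ] f i ≡ 0
∑-zero {n} f f≡0 = trans (sum-cong-≗ f≡0) (sum-replicate-zero n)

∑-mono-≤ : ∀ {n} {f g : Fin n → ℕ} → (∀ i → f i ≤ g i) → ∑[ i < n ] f i ≤ ∑[ i < n ] g i
∑-mono-≤ {zero}  f≤g = z≤n
∑-mono-≤ {suc n} f≤g = +-mono-≤ (f≤g zero) (∑-mono-≤ (λ i → f≤g (suc i)))

∑-χ-≟ : ∀ {n} (a : Fin n) → ∑[ k < n ] χ (does (k ≟ a)) ≡ 1
∑-χ-≟ {suc n} zero    = cong suc (∑-zero {n} (λ k → χ (does (suc k ≟ zero))) (λ k → refl))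
∑-χ-≟ {suc n} (suc a) = ∑-χ-≟ a

∑³ : ∀ {n} → (Fin n → Fin n → Fin n → ℕ) → ℕ
∑³ {n} F = ∑[ i < n ] ∑[ j < n ] ∑[ k < n ] F i j k

∑³-cong : ∀ {n} {F G : Fin n → Fin n → Fin n → ℕ} →
  (∀ i j k → F i j k ≡ G i j k) → ∑³ F ≡ ∑³ G
∑³-cong F≡G = sum-cong-≗ (λ i → sum-cong-≗ (λ j → sum-cong-≗ (F≡G i j)))

∑³-distrib-+ : ∀ {n} (F G : Fin n → Fin n → Fin n → ℕ) →
  ∑³ (λ i j k → F i j k + G i j k) ≡ ∑³ F + ∑³ G
∑³-distrib-+ {n} F G = begin
  ∑³ (λ i j k → F i j k + G i j k)
    ≡⟨ sum-cong-≗ (λ i → trans (sum-cong-≗ (λ j → ∑-distrib-+ (F i j) (G i j)))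
                               (∑-distrib-+ (λ j → ∑[ k < n ] F i j k) (λ j → ∑[ k < n ] G i j k))) ⟩
  ∑[ i < n ] (∑[ j < n ] ∑[ k < n ] F i j k + ∑[ j < n ] ∑[ k < n ] G i j k)
    ≡⟨ ∑-distrib-+ (λ i → ∑[ j < n ] ∑[ k < n ] F i j k) (λ i → ∑[ j < n ] ∑[ k < n ] G i j k) ⟩
  ∑³ F + ∑³ G ∎
  where open ≡-Reasoning

∑³-swap₂₃ : ∀ {n} (F : Fin n → Fin n → Fin n → ℕ) → ∑³ F ≡ ∑³ (λ i j k → F i k j)
∑³-swap₂₃ F = sum-cong-≗ (λ i → ∑-comm (F i))

∑³-rotate : ∀ {n} (F : Fin n → Fin n → Fin n → ℕ) → ∑³ F ≡ ∑³ (λ k i j → F i j k)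
∑³-rotate {n} F = trans (∑³-swap₂₃ F) (∑-comm (λ i k → ∑[ j < n ] F i j k))

length-filter-map-singleton : ∀ {A B : Set} {P : B → Set} (P? : Decidable P) (f : A → B) b a →
  length (filter P? (map f (if b then a ∷ [] else []))) ≡ χ b * χ (does (P? (f a)))
length-filter-map-singleton P? f false a = refl
length-filter-map-singleton P? f true  a with does (P? (f a))
... | true  = refl
... | false = refl

length-filter-map-concatMap : ∀ {A B I : Set} {P : B → Set} (P? : Decidable P) (f : A → B)
  (G : I → List A) {n} (g : Fin n → I) →
  length (filter P? (map f (concatMap G (tabulate g)))) ≡
  ∑[ i < n ] length (filter P? (map f (G (g i))))
length-filter-map-concatMap P? f G {zero}  g = refl
length-filter-map-concatMap P? f G {suc n} g = begin
  length (filter P? (map f (G (g zero) ++ rest)))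
    ≡⟨ cong (λ xs → length (filter P? xs)) (map-++ f (G (g zero)) rest) ⟩
  length (filter P? (map f (G (g zero)) ++ map f rest))
    ≡⟨ cong length (filter-++ P? (map f (G (g zero))) (map f rest)) ⟩
  length (filter P? (map f (G (g zero))) ++ filter P? (map f rest))
    ≡⟨ length-++ (filter P? (map f (G (g zero)))) ⟩
  length (filter P? (map f (G (g zero)))) + length (filter P? (map f rest))
    ≡⟨ cong (length (filter P? (map f (G (g zero)))) +_)
            (length-filter-map-concatMap P? f G (λ i → g (suc i))) ⟩
  ∑[ i < suc n ] length (filter P? (map f (G (g i)))) ∎
  where
  open ≡-Reasoning
  open Data.List using (_++_)
  rest = concatMap G (tabulate (λ i → g (suc i)))

lt : ∀ {n} → Fin n → Fin n → ℕ
lt i j = χ (toℕ i <ᵇ toℕ j)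

lt-yes : ∀ {n} {i j : Fin n} → toℕ i < toℕ j → lt i j ≡ 1
lt-yes {i = i} {j} i<j with toℕ i <ᵇ toℕ j | <⇒<ᵇ i<j
... | true | _ = refl

lt-no : ∀ {n} {i j : Fin n} → toℕ j < toℕ i → lt i j ≡ 0
lt-no {i = i} {j} j<i with toℕ i <ᵇ toℕ j in e
... | true  = ⊥-elim (<-asym j<i (<ᵇ⇒< (toℕ i) (toℕ j) (subst T (sym e) tt)))
... | false = refl

lt-split-by-values : ∀ {n} (i j k : Fin n) {ij jk kj ik ki} →
  lt i j ≡ ij → lt j k ≡ jk → lt k j ≡ kj → lt i k ≡ ik → lt k i ≡ ki →
  ij ≡ ij * jk + ik * kj + ki * ij → lt i j ≡ lt i j * lt j k + lt i k * lt k j + lt k i * lt i j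
lt-split-by-values i j k refl refl refl refl refl e = e

-- Each i < j is, relative to a third index k, in exactly one of the positions i<j<k, i<k<j, k<i<j.
lt-split : ∀ {n} (i j k : Fin n) → i ≢ j → i ≢ k → j ≢ k →
  lt i j ≡ lt i j * lt j k + lt i k * lt k j + lt k i * lt i j
lt-split i j k i≢j i≢k j≢k with <-cmp (toℕ i) (toℕ j) | <-cmp (toℕ j) (toℕ k) | <-cmp (toℕ i) (toℕ k)
... | tri≈ _ i≡j _ | _ | _ = contradiction (toℕ-injective i≡j) i≢j
... | _ | tri≈ _ j≡k _ | _ = contradiction (toℕ-injective j≡k) j≢k
... | _ | _ | tri≈ _ i≡k _ = contradiction (toℕ-injective i≡k) i≢k
... | tri< i<j _ _ | tri< j<k _ _ | tri> _ _ k<i = contradiction (<-trans i<j j<k) (<-asym k<i)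
... | tri> _ _ j<i | tri> _ _ k<j | tri< i<k _ _ = contradiction (<-trans k<j j<i) (<-asym i<k)
... | tri< i<j _ _ | tri< j<k _ _ | tri< i<k _ _ =
  lt-split-by-values i j k (lt-yes i<j) (lt-yes j<k) (lt-no j<k) (lt-yes i<k) (lt-no i<k) refl
... | tri< i<j _ _ | tri> _ _ k<j | tri< i<k _ _ =
  lt-split-by-values i j k (lt-yes i<j) (lt-no k<j) (lt-yes k<j) (lt-yes i<k) (lt-no i<k) refl
... | tri< i<j _ _ | tri> _ _ k<j | tri> _ _ k<i =
  lt-split-by-values i j k (lt-yes i<j) (lt-no k<j) (lt-yes k<j) (lt-no k<i) (lt-yes k<i) refl
... | tri> _ _ j<i | tri< j<k _ _ | tri< i<k _ _ =
  lt-split-by-values i j k (lt-no j<i) (lt-yes j<k) (lt-no j<k) (lt-yes i<k) (lt-no i<k) refl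
... | tri> _ _ j<i | tri< j<k _ _ | tri> _ _ k<i =
  lt-split-by-values i j k (lt-no j<i) (lt-yes j<k) (lt-no j<k) (lt-no k<i) (lt-yes k<i) refl
... | tri> _ _ j<i | tri> _ _ k<j | tri> _ _ k<i =
  lt-split-by-values i j k (lt-no j<i) (lt-no k<j) (lt-yes k<j) (lt-no k<i) (lt-yes k<i) refl

nIn-∑ : ∀ C x → nIn C x ≡ ∑[ i < 24 ] ∑[ j < 24 ] (lt i j * χ (C (flip (flip x i) j)))
nIn-∑ C x = begin
  nIn C x
    ≡⟨ length-filter-map-concatMap C? neighbour rowPairs id ⟩
  ∑[ i < 24 ] length (filter C? (map neighbour (rowPairs i)))
    ≡⟨ sum-cong-≗ (λ i → length-filter-map-concatMap C? neighbour (pair i) id) ⟩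
  ∑[ i < 24 ] ∑[ j < 24 ] length (filter C? (map neighbour (pair i j)))
    ≡⟨ sum-cong-≗ (λ i → sum-cong-≗ (λ j →
         trans (length-filter-map-singleton C? neighbour (toℕ i <ᵇ toℕ j) (i , j))
               (cong (λ b → lt i j * χ b) (does-≟-true (C (flip (flip x i) j)))))) ⟩
  ∑[ i < 24 ] ∑[ j < 24 ] (lt i j * χ (C (flip (flip x i) j))) ∎
  where
  open ≡-Reasoning
  C? : Decidable (λ w → C w ≡ true)
  C? w = C w ≟B true
  neighbour : Fin 24 × Fin 24 → Word
  neighbour (i , j) = flip (flip x i) j
  pair : Fin 24 → Fin 24 → List (Fin 24 × Fin 24)
  pair i j = if toℕ i <ᵇ toℕ j then (i , j) ∷ [] else []
  rowPairs : Fin 24 → List (Fin 24 × Fin 24)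
  rowPairs i = concatMap (pair i) (tabulate id)

module _ (C : Word → Bool) where

  Full : Word → Set
  Full t = ∀ m → C (flip t m) ≡ true

  -- Opaque, since otherwise does (Full? t) unfolds into a 24-fold conjunction wherever it is compared.
  opaque
    Full? : Decidable Full
    Full? t = all? (λ m → C (flip t m) ≟B true)

  χ-Full?≡0 : ∀ t m → C (flip t m) ≡ false → χ (does (Full? t)) ≡ 0
  χ-Full?≡0 t m out = cong χ (dec-false (Full? t) λ full → contradiction (trans (sym (full m)) out) λ ())

  Full-flip⇒∈ : ∀ x k → Full (flip x k) → C x ≡ true
  Full-flip⇒∈ x k full = subst (λ w → C w ≡ true) (flip-involutive x k) (full k)

Touches : ∀ {n} (k k' i j : Fin n) → Set
Touches k k' i j = i ≡ k ⊎ i ≡ k' ⊎ j ≡ k ⊎ j ≡ k'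

touches? : ∀ {n} (k k' i j : Fin n) → Dec (Touches k k' i j)
touches? k k' i j = (i ≟ k) ⊎-dec (i ≟ k') ⊎-dec (j ≟ k) ⊎-dec (j ≟ k')

pairsTouching : ∀ {n} (k k' : Fin n) → ℕ
pairsTouching {n} k k' = ∑[ i < n ] ∑[ j < n ] (lt i j * χ (does (touches? k k' i j)))

pairsTouching-bound? : Dec (∀ (k k' : Fin 24) → k ≡ k' ⊎ 45 ≤ pairsTouching k k')
pairsTouching-bound? = all? λ k → all? λ k' → (k ≟ k') ⊎-dec (45 ≤? pairsTouching k k')

pairsTouching-bound : ∀ (k k' : Fin 24) → k ≡ k' ⊎ 45 ≤ pairsTouching k k'
pairsTouching-bound = toWitness {a? = pairsTouching-bound?} _

45≤pairsTouching : ∀ (k k' : Fin 24) → k ≢ k' → 45 ≤ pairsTouching k k'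
45≤pairsTouching k k' k≢k' = [ (λ k≡k' → contradiction k≡k' k≢k') , id ]′ (pairsTouching-bound k k')

45≤nIn : ∀ C x k k' → k ≢ k' → Full C (flip x k) → Full C (flip x k') → 45 ≤ nIn C x
45≤nIn C x k k' k≢k' full full' = ≤-trans (45≤pairsTouching k k' k≢k')
  (subst (pairsTouching k k' ≤_) (sym (nIn-∑ C x))
    (∑-mono-≤ λ i → ∑-mono-≤ λ j → *-monoʳ-≤ (lt i j) (touching≤ i j)))
  where
  via-second : ∀ {k} → Full C (flip x k) → ∀ i → C (flip (flip x i) k) ≡ true
  via-second {k} full i = subst (λ w → C w ≡ true) (flip-comm x k i) (full i)
  touching∈C : ∀ i j → Touches k k' i j → C (flip (flip x i) j) ≡ true
  touching∈C i j (inj₁ refl)               = full j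
  touching∈C i j (inj₂ (inj₁ refl))        = full' j
  touching∈C i j (inj₂ (inj₂ (inj₁ refl))) = via-second full i
  touching∈C i j (inj₂ (inj₂ (inj₂ refl))) = via-second full' i
  touching≤ : ∀ i j → χ (does (touches? k k' i j)) ≤ χ (C (flip (flip x i) j))
  touching≤ i j = χ-does-≤ (touches? k k' i j) (touching∈C i j)

lt-split-weighted : ∀ {n} (i j k : Fin n) v → v ≡ 0 ⊎ (i ≢ j × i ≢ k × j ≢ k) →
  lt i j * v ≡ lt i j * lt j k * v + lt i k * lt k j * v + lt k i * lt i j * v
lt-split-weighted i j k .0 (inj₁ refl) = annihilate (lt i j) (lt j k) (lt i k) (lt k j) (lt k i) (lt i j)
  where
  annihilate : ∀ a b c d e f → a * 0 ≡ a * b * 0 + c * d * 0 + e * f * 0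
  annihilate = solve-∀
lt-split-weighted i j k v (inj₂ (i≢j , i≢k , j≢k)) =
  trans (cong (_* v) (lt-split i j k i≢j i≢k j≢k)) (distrib (lt i j * lt j k) (lt i k * lt k j) (lt k i * lt i j) v)
  where
  distrib : ∀ a b c v → (a + b + c) * v ≡ a * v + b * v + c * v
  distrib = solve-∀

module Around (C : Word → Bool) (y : Word) (y∉C : C y ≡ false) where

  centre : Fin 24 → Fin 24 → Fin 24 → Word
  centre i j k = flip (flip (flip y i) j) k

  full : Fin 24 → Fin 24 → Fin 24 → ℕ
  full i j k = χ (does (Full? C (centre i j k)))

  full-swap₁₂ : ∀ i j k → full i j k ≡ full j i k
  full-swap₁₂ i j k = cong (λ w → χ (does (Full? C (flip w k)))) (flip-comm y i j)

  full-swap₂₃ : ∀ i j k → full i j k ≡ full i k j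
  full-swap₂₃ i j k = cong (λ t → χ (does (Full? C t))) (flip-comm (flip y i) j k)

  full-rotate : ∀ i j k → full j k i ≡ full i j k
  full-rotate i j k = trans (full-swap₂₃ j k i) (full-swap₁₂ j i k)

  full-through-y : ∀ i j k m → flip (centre i j k) m ≡ y → full i j k ≡ 0
  full-through-y i j k m through-y =
    χ-Full?≡0 C (centre i j k) m (subst (λ w → C w ≡ false) (sym through-y) y∉C)

  full-iik : ∀ i k → full i i k ≡ 0
  full-iik i k = full-through-y i i k k (trans (flip-involutive _ k) (flip-involutive y i))

  full-ijj : ∀ i j → full i j j ≡ 0
  full-ijj i j = full-through-y i j j i
    (trans (cong (λ w → flip w i) (flip-involutive (flip y i) j)) (flip-involutive y i))

  full-zero-or-distinct : ∀ i j k → full i j k ≡ 0 ⊎ (i ≢ j × i ≢ k × j ≢ k)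
  full-zero-or-distinct i j k with i ≟ j | i ≟ k | j ≟ k
  ... | yes refl | _        | _        = inj₁ (full-iik i k)
  ... | no _     | yes refl | _        = inj₁ (trans (full-swap₂₃ i j i) (full-iik i j))
  ... | no _     | no _     | yes refl = inj₁ (full-ijj i j)
  ... | no i≢j   | no i≢k   | no j≢k   = inj₂ (i≢j , i≢k , j≢k)

  SharedNeighbour : Set
  SharedNeighbour = ∃ λ i → ∃ λ j → ∃ λ k → ∃ λ k' →
    k ≢ k' × Full C (centre i j k) × Full C (centre i j k')

  sharedNeighbour? : Dec SharedNeighbour
  sharedNeighbour? = any? λ i → any? λ j → any? λ k → any? λ k' →
    ¬? (k ≟ k') ×-dec Full? C (centre i j k) ×-dec Full? C (centre i j k')

  module Unshared (y-even : IsVertex y) (U : IsUnionOfSpheres C) (unshared : ¬ SharedNeighbour) where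

    χ-neighbour≡∑full : ∀ i j → χ (C (flip (flip y i) j)) ≡ ∑[ k < 24 ] full i j k
    χ-neighbour≡∑full i j with C (flip (flip y i) j) in x∈?
    ... | false = sym (∑-zero (full i j) λ k →
      χ-Full?≡0 C (centre i j k) k (trans (cong C (flip-involutive _ k)) x∈?))
    ... | true with U (flip (flip y i) j) (IsVertex-flip-flip y i j y-even) x∈?
    ...   | t , _ , (a , x≡ta) , sphere⊆C = sym (trans (sum-cong-≗ full≡δ) (∑-χ-≟ a))
      where
      full-a : Full C (centre i j a)
      full-a m = subst (λ t' → C (flip t' m) ≡ true)
        (sym (trans (cong (λ w → flip w a) x≡ta) (flip-involutive t a))) (sphere⊆C (flip t m) (m , refl))
      full≡δ : ∀ k → full i j k ≡ χ (does (k ≟ a))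
      full≡δ k with k ≟ a
      ... | yes refl = cong χ (dec-true (Full? C (centre i j k)) full-a)
      ... | no k≢a   = cong χ (dec-false (Full? C (centre i j k)) λ full-k →
                         unshared (i , j , k , a , k≢a , full-k , full-a))

    A : ℕ
    A = ∑³ (λ i j k → lt i j * lt j k * full i j k)

    nIn≡A+A+A : nIn C y ≡ A + A + A
    nIn≡A+A+A = begin
      nIn C y
        ≡⟨ nIn-∑ C y ⟩
      ∑[ i < 24 ] ∑[ j < 24 ] (lt i j * χ (C (flip (flip y i) j)))
        ≡⟨ sum-cong-≗ (λ i → sum-cong-≗ λ j →
             trans (cong (lt i j *_) (χ-neighbour≡∑full i j)) (*-distribˡ-sum (lt i j) (full i j))) ⟩
      ∑³ (λ i j k → lt i j * full i j k)
        ≡⟨ ∑³-cong (λ i j k → lt-split-weighted i j k (full i j k) (full-zero-or-distinct i j k)) ⟩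
      ∑³ (λ i j k → T₁ i j k + T₂ i j k + T₃ i j k)
        ≡⟨ trans (∑³-distrib-+ (λ i j k → T₁ i j k + T₂ i j k) T₃) (cong (_+ ∑³ T₃) (∑³-distrib-+ T₁ T₂)) ⟩
      A + ∑³ T₂ + ∑³ T₃
        ≡⟨ cong₂ (λ a b → A + a + b) T₂≡A T₃≡A ⟩
      A + A + A ∎
      where
      open ≡-Reasoning
      T₁ T₂ T₃ : Fin 24 → Fin 24 → Fin 24 → ℕ
      T₁ i j k = lt i j * lt j k * full i j k
      T₂ i j k = lt i k * lt k j * full i j k
      T₃ i j k = lt k i * lt i j * full i j k
      T₂≡A : ∑³ T₂ ≡ A
      T₂≡A = trans (∑³-swap₂₃ T₂) (∑³-cong λ i j k → cong (lt i j * lt j k *_) (sym (full-swap₂₃ i j k)))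
      T₃≡A : ∑³ T₃ ≡ A
      T₃≡A = trans (∑³-rotate T₃) (∑³-cong λ i j k → cong (lt i j * lt j k *_) (full-rotate i j k))

lemma8 : (C : Word → Bool) (c : ℕ) → c ≤ 256 → IsUnionOfSpheres C →
    PerfectColoring C (20 + c) (256 ∸ c) c (276 ∸ c) →
    (3 ∣ c) ⊎ (25 ≤ c)
lemma8 C c _ U (_ , (y , y-even , y∉C) , in-C , out-C) =
  [ inj₂ ∘ shared⇒25≤c , inj₁ ∘ unshared⇒3∣c ]′ (toSum sharedNeighbour?)
  where
  open Around C y y∉C
  shared⇒25≤c : SharedNeighbour → 25 ≤ c
  shared⇒25≤c (i , j , k , k' , k≢k' , full-k , full-k') =
    +-cancelˡ-≤ 20 25 c (subst (45 ≤_) (proj₁ (in-C x x-even x∈C)) (45≤nIn C x k k' k≢k' full-k full-k'))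
    where
    x : Word
    x = flip (flip y i) j
    x-even : IsVertex x
    x-even = IsVertex-flip-flip y i j y-even
    x∈C : C x ≡ true
    x∈C = Full-flip⇒∈ C x k full-k
  unshared⇒3∣c : ¬ SharedNeighbour → 3 ∣ c
  unshared⇒3∣c unshared = divides A (trans (sym (proj₁ (out-C y y-even y∉C))) (trans nIn≡A+A+A (three A)))
    where
    open Unshared y-even U unshared
    three : ∀ a → a + a + a ≡ a * 3
    three = solve-∀
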